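{- Let $R$ be a commutative ring with $1$, let $m,k,n$ be positive integers and let $a_1,\dots,a_m,b_1,\dots,b_k\in R$. Then $$\mathrm{comp}_n(\{a_1,\dots,a_m|b_1,\dots,b_k\})=\mathrm{comp}_n(\{a_1,\dots,a_{m-1}|b_1,\dots,b_{k-1}\})+(b_k-a_m)\,\mathrm{comp}_{n-1}(\{a_1,\dots,a_{m-1}|b_1,\dots,b_k\}).$$
   Context: A hybrid set on a universe $U$ is a function $f:U\to\mathbb{Z}$, added pointwise. $\{a_1,\dots,a_m|b_1,\dots,b_k\}$ denotes the hybrid set $\sum_{i=1}^m\{a_i|\}-\sum_{j=1}^k\{b_j|\}$, where $\{c|\}$ has multiplicity $1$ at $c$ and $0$ elsewhere (so repeated or coinciding entries add up or cancel). For a finitely supported hybrid set $V$ of elements of $R$, $\mathrm{comp}_n(V)$ is the coefficient of $t^n$ in $\prod_{x\in R}(1-xt)^{V(x)}\in R[[t]]$. -}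

module Defs where

open import Level using (Level)
open import Algebra.Bundles using (CommutativeRing)
open import Data.Nat using (ℕ; zero; suc; _∸_)
open import Data.Integer using (ℤ; +_; -[1+_])
open import Data.Product using (_×_; _,_)
open import Data.List using (List; []; _∷_; _++_; map)
open import Data.Vec using (Vec; toList)

module _ {c ℓ : Level} (R : CommutativeRing c ℓ) where
  open CommutativeRing R using (Carrier; _+_; _*_; -_; 0#; 1#)

  Series : Set c
  Series = ℕ → Carrier

  sumTo : ℕ → (ℕ → Carrier) → Carrier
  sumTo zero    f = f zero
  sumTo (suc n) f = sumTo n f + f (suc n)

  _⊛_ : Series → Series → Series
  (f ⊛ g) n = sumTo n (λ i → f i * g (n ∸ i))

  oneS : Series
  oneS zero    = 1#
  oneS (suc _) = 0#

  linS : Carrier → Series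
  linS x zero          = 1#
  linS x (suc zero)    = - x
  linS x (suc (suc _)) = 0#

  -- the series (1 - x t)^{-1} = Σ_j x^j t^j  (the inverse of linS x in R[[t]])
  geoS : Carrier → Series
  geoS x zero    = 1#
  geoS x (suc j) = x * geoS x j

  powS : Carrier → ℕ → Series
  powS x zero    = oneS
  powS x (suc e) = linS x ⊛ powS x e

  invPowS : Carrier → ℕ → Series
  invPowS x zero    = oneS
  invPowS x (suc e) = geoS x ⊛ invPowS x e

  factorS : Carrier → ℤ → Series
  factorS x (+ e)      = powS x e
  factorS x -[1+ e ]   = invPowS x (suc e)

  -- A finitely supported hybrid set, presented as a formal sum
  -- Σ_i e_i · {x_i|} of singletons (entries may repeat / cancel).
  HybridSet : Set c
  HybridSet = List (Carrier × ℤ)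

  hyb : ∀ {m k} → Vec Carrier m → Vec Carrier k → HybridSet
  hyb as bs = map (λ a → a , + 1) (toList as) ++ map (λ b → b , -[1+ 0 ]) (toList bs)

  prodS : HybridSet → Series
  prodS []            = oneS
  prodS ((x , e) ∷ V) = factorS x e ⊛ prodS V

  comp : ℕ → HybridSet → Carrier
  comp n V = prodS V n

module Submission where

open import Defs
open import Level using (Level)
open import Algebra.Bundles using (CommutativeRing)
open import Data.Nat using (ℕ; suc; zero; _∸_; _≤_; z≤n)
open import Data.Nat.Properties using (+-∸-assoc; n∸n≡0; m≤n⇒m≤1+n; ≤-refl)
open import Data.Integer using (ℤ; +_; -[1+_])
open import Data.Product using (_×_; _,_)
open import Data.Vec using (Vec; _∷ʳ_; toList)
open import Data.List using ([]; _∷_; _++_; map; [_])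
open import Data.List.Properties using (map-++; ++-assoc; ++-identityʳ)
open import Data.Vec.Properties using (toList-∷ʳ)
import Algebra.Properties.CommutativeSemigroup as CommutativeSemigroupProperties
open import Relation.Binary.PropositionalEquality as ≡ using (_≡_)
import Relation.Binary.Reasoning.Setoid as SetoidReasoning

-- The key identity is (1 - a t)(1 - b t)⁻¹ = 1 + (b - a)·t·(1 - b t)⁻¹, which follows from
-- (1 - b t)⁻¹ = 1 + b·t·(1 - b t)⁻¹.  Multiplying on the left by a series commutes with
-- f ↦ f + a·t·g, so the identity survives multiplication by the remaining factors of the
-- hybrid set taken in list order; no associativity or commutativity of ⊛ is ever needed.

module PowerSeries {c ℓ : Level} (R : CommutativeRing c ℓ) where
  open CommutativeRing R hiding (zero)
  open CommutativeSemigroupProperties +-commutativeSemigroup using (interchange)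
  open CommutativeSemigroupProperties *-commutativeSemigroup using (x∙yz≈y∙xz)

  private
    _⋆_ : Series R → Series R → Series R
    _⋆_ = _⊛_ R
    infixl 7 _⋆_

    Σ[≤_] : ℕ → (ℕ → Carrier) → Carrier
    Σ[≤_] = sumTo R

  infix 4 _≐_
  _≐_ : Series R → Series R → Set ℓ
  f ≐ g = ∀ n → f n ≈ g n

  ≐-sym : ∀ {f g} → f ≐ g → g ≐ f
  ≐-sym f≐g n = sym (f≐g n)

  ≐-trans : ∀ {f g h} → f ≐ g → g ≐ h → f ≐ h
  ≐-trans f≐g g≐h n = trans (f≐g n) (g≐h n)

  sumTo-cong : ∀ n {f g : ℕ → Carrier} → (∀ i → i ≤ n → f i ≈ g i) → Σ[≤ n ] f ≈ Σ[≤ n ] g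
  sumTo-cong zero    f≈g = f≈g 0 z≤n
  sumTo-cong (suc n) f≈g =
    +-cong (sumTo-cong n (λ i i≤n → f≈g i (m≤n⇒m≤1+n i≤n))) (f≈g (suc n) ≤-refl)

  sumTo-zero : ∀ n {f : ℕ → Carrier} → (∀ i → i ≤ n → f i ≈ 0#) → Σ[≤ n ] f ≈ 0#
  sumTo-zero zero    f≈0 = f≈0 0 z≤n
  sumTo-zero (suc n) f≈0 =
    trans (+-cong (sumTo-zero n (λ i i≤n → f≈0 i (m≤n⇒m≤1+n i≤n))) (f≈0 (suc n) ≤-refl))
          (+-identityʳ 0#)

  sumTo-distrib-+ : ∀ n (f g : ℕ → Carrier) → Σ[≤ n ] (λ i → f i + g i) ≈ Σ[≤ n ] f + Σ[≤ n ] g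
  sumTo-distrib-+ zero    f g = refl
  sumTo-distrib-+ (suc n) f g = trans (+-congʳ (sumTo-distrib-+ n f g)) (interchange _ _ _ _)

  *-distribˡ-sumTo : ∀ n a (f : ℕ → Carrier) → Σ[≤ n ] (λ i → a * f i) ≈ a * Σ[≤ n ] f
  *-distribˡ-sumTo zero    a f = refl
  *-distribˡ-sumTo (suc n) a f = trans (+-congʳ (*-distribˡ-sumTo n a f)) (sym (distribˡ a _ _))

  sumTo-suc-head : ∀ n (f : ℕ → Carrier) → Σ[≤ suc n ] f ≈ f 0 + Σ[≤ n ] (λ i → f (suc i))
  sumTo-suc-head zero    f = refl
  sumTo-suc-head (suc n) f = trans (+-congʳ (sumTo-suc-head n f)) (+-assoc _ _ _)

  -- When i ≤ n, the index suc n ∸ i of a convolution term is a successor, so series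
  -- vanishing outside 0 (oneS) or shifted by one (t·_) only see the last term.
  ∸-suc : ∀ {i n} → i ≤ n → suc n ∸ i ≡ suc (n ∸ i)
  ∸-suc = +-∸-assoc 1

  infixr 8 t·_
  t·_ : Series R → Series R
  (t· g) zero    = 0#
  (t· g) (suc n) = g n

  infixl 6 _+[_]t·_
  _+[_]t·_ : Series R → Carrier → Series R → Series R
  (f +[ a ]t· g) n = f n + a * (t· g) n

  +[]t·-cong : ∀ {f f′ g g′} a → f ≐ f′ → g ≐ g′ → f +[ a ]t· g ≐ f′ +[ a ]t· g′
  +[]t·-cong a f≐f′ g≐g′ zero    = +-congʳ (f≐f′ zero)
  +[]t·-cong a f≐f′ g≐g′ (suc n) = +-cong (f≐f′ (suc n)) (*-congˡ (g≐g′ n))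

  ⋆-congʳ : ∀ {h h′} f → h ≐ h′ → h ⋆ f ≐ h′ ⋆ f
  ⋆-congʳ f h≐h′ n = sumTo-cong n (λ i _ → *-congʳ (h≐h′ i))

  ⋆-congˡ : ∀ h {f f′} → f ≐ f′ → h ⋆ f ≐ h ⋆ f′
  ⋆-congˡ h f≐f′ n = sumTo-cong n (λ i _ → *-congˡ (f≐f′ (n ∸ i)))

  ⋆-identityʳ : ∀ h → h ⋆ oneS R ≐ h
  ⋆-identityʳ h zero    = *-identityʳ (h 0)
  ⋆-identityʳ h (suc n) = trans (+-cong early last) (+-identityˡ (h (suc n)))
    where
    early : Σ[≤ n ] (λ i → h i * oneS R (suc n ∸ i)) ≈ 0#
    early = sumTo-zero n (λ i i≤n →
      trans (*-congˡ (reflexive (≡.cong (oneS R) (∸-suc i≤n)))) (zeroʳ (h i)))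
    last : h (suc n) * oneS R (suc n ∸ suc n) ≈ h (suc n)
    last = trans (*-congˡ (reflexive (≡.cong (oneS R) (n∸n≡0 n)))) (*-identityʳ (h (suc n)))

  ⋆-t·ʳ : ∀ h g → h ⋆ t· g ≐ t· (h ⋆ g)
  ⋆-t·ʳ h g zero    = zeroʳ (h 0)
  ⋆-t·ʳ h g (suc n) = trans (+-cong early last) (+-identityʳ ((h ⋆ g) n))
    where
    early : Σ[≤ n ] (λ i → h i * (t· g) (suc n ∸ i)) ≈ (h ⋆ g) n
    early = sumTo-cong n (λ i i≤n → *-congˡ (reflexive (≡.cong (t· g) (∸-suc i≤n))))
    last : h (suc n) * (t· g) (suc n ∸ suc n) ≈ 0#
    last = trans (*-congˡ (reflexive (≡.cong (t· g) (n∸n≡0 n)))) (zeroʳ (h (suc n)))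

  ⋆-distribˡ-+[]t· : ∀ h f a g → h ⋆ (f +[ a ]t· g) ≐ h ⋆ f +[ a ]t· h ⋆ g
  ⋆-distribˡ-+[]t· h f a g n = begin
    Σ[≤ n ] (λ i → h i * (f (n ∸ i) + a * (t· g) (n ∸ i)))
      ≈⟨ sumTo-cong n (λ i _ → trans (distribˡ _ _ _) (+-congˡ (x∙yz≈y∙xz _ _ _))) ⟩
    Σ[≤ n ] (λ i → h i * f (n ∸ i) + a * (h i * (t· g) (n ∸ i)))
      ≈⟨ sumTo-distrib-+ n _ _ ⟩
    (h ⋆ f) n + Σ[≤ n ] (λ i → a * (h i * (t· g) (n ∸ i)))
      ≈⟨ +-congˡ (*-distribˡ-sumTo n a _) ⟩
    (h ⋆ f) n + a * (h ⋆ t· g) n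
      ≈⟨ +-congˡ (*-congˡ (⋆-t·ʳ h g n)) ⟩
    (h ⋆ f) n + a * (t· (h ⋆ g)) n ∎
    where open SetoidReasoning setoid

  linS-tail-⋆ : ∀ x (f : Series R) n → Σ[≤ n ] (λ i → linS R x (suc i) * f (n ∸ i)) ≈ - x * f n
  linS-tail-⋆ x f zero    = refl
  linS-tail-⋆ x f (suc n) =
    trans (sumTo-suc-head n _) (trans (+-congˡ (sumTo-zero n (λ i _ → zeroˡ _))) (+-identityʳ _))

  linS-⋆ : ∀ x (f : Series R) → linS R x ⋆ f ≐ f +[ - x ]t· f
  linS-⋆ x f zero    = trans (*-identityˡ (f 0)) (sym (trans (+-congˡ (zeroʳ (- x))) (+-identityʳ (f 0))))
  linS-⋆ x f (suc n) = trans (sumTo-suc-head n _) (+-cong (*-identityˡ (f (suc n))) (linS-tail-⋆ x f n))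

  geoS-unfold : ∀ x → geoS R x ≐ oneS R +[ x ]t· geoS R x
  geoS-unfold x zero    = sym (trans (+-congˡ (zeroʳ x)) (+-identityʳ 1#))
  geoS-unfold x (suc n) = sym (+-identityˡ _)

  factorS-one : ∀ x → factorS R x (+ 1) ≐ linS R x
  factorS-one x = ⋆-identityʳ (linS R x)

  factorS-minusOne : ∀ x → factorS R x -[1+ 0 ] ≐ geoS R x
  factorS-minusOne x = ⋆-identityʳ (geoS R x)

  mulFactors : HybridSet R → Series R → Series R
  mulFactors []            f = f
  mulFactors ((x , e) ∷ V) f = factorS R x e ⋆ mulFactors V f

  mulFactors-cong : ∀ V {f g} → f ≐ g → mulFactors V f ≐ mulFactors V g
  mulFactors-cong []            f≐g = f≐g
  mulFactors-cong ((x , e) ∷ V) f≐g = ⋆-congˡ (factorS R x e) (mulFactors-cong V f≐g)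

  mulFactors-+[]t· : ∀ V f a g → mulFactors V (f +[ a ]t· g) ≐ mulFactors V f +[ a ]t· mulFactors V g
  mulFactors-+[]t· []            f a g n = refl
  mulFactors-+[]t· ((x , e) ∷ V) f a g =
    ≐-trans (⋆-congˡ (factorS R x e) (mulFactors-+[]t· V f a g))
            (⋆-distribˡ-+[]t· (factorS R x e) (mulFactors V f) a (mulFactors V g))

  prodS-++ : ∀ V W → prodS R (V ++ W) ≐ mulFactors V (prodS R W)
  prodS-++ []            W n = refl
  prodS-++ ((x , e) ∷ V) W = ⋆-congˡ (factorS R x e) (prodS-++ V W)

  prodS-mulFactors : ∀ V → prodS R V ≐ mulFactors V (oneS R)
  prodS-mulFactors V n = trans (reflexive (≡.cong (λ W → prodS R W n) (≡.sym (++-identityʳ V))))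
                               (prodS-++ V [] n)

  prodS-∷ʳ-inverse : ∀ B b →
    prodS R (B ++ [ b , -[1+ 0 ] ]) ≐ prodS R B +[ b ]t· prodS R (B ++ [ b , -[1+ 0 ] ])
  prodS-∷ʳ-inverse B b =
    ≐-trans (prodS-++ B _)
    (≐-trans (mulFactors-cong B (≐-trans inverse (geoS-unfold b)))
    (≐-trans (mulFactors-+[]t· B _ _ _)
             (+[]t·-cong b (≐-sym (prodS-mulFactors B))
                           (≐-trans (mulFactors-cong B (≐-sym inverse)) (≐-sym (prodS-++ B _))))))
    where
    inverse : prodS R [ b , -[1+ 0 ] ] ≐ geoS R b
    inverse = ≐-trans (⋆-identityʳ _) (factorS-minusOne b)

  prodS-cancel : ∀ A a B b →
    prodS R (A ++ (a , + 1) ∷ B ++ [ b , -[1+ 0 ] ])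
      ≐ prodS R (A ++ B) +[ b - a ]t· prodS R (A ++ B ++ [ b , -[1+ 0 ] ])
  prodS-cancel A a B b =
    ≐-trans (prodS-++ A _)
    (≐-trans (mulFactors-cong A cancel)
    (≐-trans (mulFactors-+[]t· A _ _ _)
             (+[]t·-cong _ (≐-sym (prodS-++ A B)) (≐-sym (prodS-++ A _)))))
    where
    Y : Series R
    Y = prodS R (B ++ [ b , -[1+ 0 ] ])
    cancel : factorS R a (+ 1) ⋆ Y ≐ prodS R B +[ b - a ]t· Y
    cancel n = begin
      (factorS R a (+ 1) ⋆ Y) n
        ≈⟨ ≐-trans (⋆-congʳ Y (factorS-one a)) (linS-⋆ a Y) n ⟩
      Y n + - a * (t· Y) n
        ≈⟨ +-congʳ (prodS-∷ʳ-inverse B b n) ⟩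
      prodS R B n + b * (t· Y) n + - a * (t· Y) n
        ≈⟨ +-assoc _ _ _ ⟩
      prodS R B n + (b * (t· Y) n + - a * (t· Y) n)
        ≈⟨ +-congˡ (sym (distribʳ _ b (- a))) ⟩
      prodS R B n + (b - a) * (t· Y) n ∎
      where open SetoidReasoning setoid

open PowerSeries using (prodS-cancel)

map-toList-∷ʳ : ∀ {a b} {A : Set a} {B : Set b} {n} (f : A → B) x (xs : Vec A n) →
                map f (toList (xs ∷ʳ x)) ≡ map f (toList xs) ++ [ f x ]
map-toList-∷ʳ f x xs = ≡.trans (≡.cong (map f) (toList-∷ʳ x xs)) (map-++ f (toList xs) _)

mainTheorem4 : ∀ {c ℓ : Level} (R : CommutativeRing c ℓ) →
    let open CommutativeRing R in
    ∀ {m k : ℕ} (as : Vec Carrier m) (am : Carrier) (bs : Vec Carrier k) (bk : Carrier) (n : ℕ) →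
    comp R (suc n) (hyb R (as ∷ʳ am) (bs ∷ʳ bk))
    ≈ comp R (suc n) (hyb R as bs) + (bk - am) * comp R n (hyb R as (bs ∷ʳ bk))
mainTheorem4 R as am bs bk n =
  trans (reflexive (≡.cong (comp R (suc n)) split))
  (trans (prodS-cancel R A am B bk (suc n))
         (+-congˡ (*-congˡ (reflexive (≡.cong (comp R n) (≡.sym (≡.cong (A ++_) splitB)))))))
  where
  open CommutativeRing R
  pos neg : Carrier → Carrier × ℤ
  pos a = a , + 1
  neg b = b , -[1+ 0 ]
  A B : HybridSet R
  A = map pos (toList as)
  B = map neg (toList bs)
  splitB : map neg (toList (bs ∷ʳ bk)) ≡ B ++ [ neg bk ]
  splitB = map-toList-∷ʳ neg bk bs
  split : hyb R (as ∷ʳ am) (bs ∷ʳ bk) ≡ A ++ pos am ∷ B ++ [ neg bk ]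
  split = ≡.trans (≡.cong₂ _++_ (map-toList-∷ʳ pos am as) splitB) (++-assoc A [ pos am ] _)
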